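{- Let $m,n\in\mathbb{N}$, let $C_1=\{a_1,\dots,a_m\}$ and $C_2=\{b_1,\dots,b_n\}$ be disjoint sets, and consider the chains $\mathfrak{c}_1=(C_1,\le_1)$, $\mathfrak{c}_2=(C_2,\le_2)$ with $a_i\le_1 a_j\iff i\le j$ and $b_i\le_2 b_j\iff i\le j$. Let $\mathrm{PP}^{(2)}_{m,n}$ be the set of plane partitions with $m$ rows, $n$ columns and largest part at most $2$, and let $\mathfrak{C}^{\bullet}_{m,n}$ be the set of proper mergings of $\mathfrak{c}_1$ and $\mathfrak{c}_2$. For $\pi\in\mathrm{PP}^{(2)}_{m,n}$ define $R_\pi\subseteq C_1\times C_2$ and $S_\pi\subseteq C_2\times C_1$ by \[ a_i\,R_\pi\,b_{n-j+1}\iff \pi_{i,j}=2,\qquad b_{n-j+1}\,S_\pi\,a_i\iff \pi_{i,j}=0, \] for $1\le i\le m$, $1\le j\le n$. Then the map $\pi\mapsto(R_\pi,S_\pi)$ is a bijection from $\mathrm{PP}^{(2)}_{m,n}$ onto $\mathfrak{C}^{\bullet}_{m,n}$.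
   Context: A plane partition with $m$ rows, $n$ columns and largest part at most $2$ is an $m\times n$ array $(\pi_{i,j})$ of integers in $\{0,1,2\}$ which is weakly decreasing along each row and along each column. A quasi-order is a reflexive, transitive binary relation. For disjoint quasi-ordered sets $(P,\leftarrow_P)$, $(Q,\leftarrow_Q)$ and relations $R\subseteq P\times Q$, $S\subseteq Q\times P$, define $\leftarrow_{R,S}$ on $P\cup Q$ by: $p\leftarrow_{R,S}q$ iff $p\leftarrow_P q$ or $p\leftarrow_Q q$ or $(p,q)\in R$ or $(p,q)\in S$. $(R,S)$ is a merging of $P$ and $Q$ if $\leftarrow_{R,S}$ is a quasi-order on $P\cup Q$, and a proper merging if additionally $R\cap S^{ -1}=\emptyset$. -}

module Defs where

open import Data.Nat using (ℕ; _≤_; _≡ᵇ_)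
open import Data.Fin using (Fin; opposite) renaming (_≤_ to _≤F_)
open import Data.Bool using (Bool; true)
open import Data.Sum using (_⊎_; inj₁; inj₂)
open import Data.Product using (_×_; Σ)
open import Relation.Binary.PropositionalEquality using (_≡_)
open import Relation.Nullary using (¬_)

record IsPP2 (m n : ℕ) (π : Fin m → Fin n → ℕ) : Set where
  field
    bounded : ∀ i j → π i j ≤ 2
    rowDec  : ∀ i j j' → j ≤F j' → π i j' ≤ π i j
    colDec  : ∀ i i' j → i ≤F i' → π i' j ≤ π i j

-- Elements of C₁ ⊎ C₂: inj₁ i is a_{i+1}, inj₂ k is b_{k+1}.
Merged : {m n : ℕ} → (Fin m → Fin n → Bool) → (Fin n → Fin m → Bool) →
         Fin m ⊎ Fin n → Fin m ⊎ Fin n → Set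
Merged R S (inj₁ i) (inj₁ i') = i ≤F i'
Merged R S (inj₁ i) (inj₂ k)  = R i k ≡ true
Merged R S (inj₂ k) (inj₁ i)  = S k i ≡ true
Merged R S (inj₂ k) (inj₂ k') = k ≤F k'

IsQuasiOrder : {A : Set} → (A → A → Set) → Set
IsQuasiOrder {A} _∼_ = (∀ x → x ∼ x) × (∀ x y z → x ∼ y → y ∼ z → x ∼ z)

IsMerging : {m n : ℕ} → (Fin m → Fin n → Bool) → (Fin n → Fin m → Bool) → Set
IsMerging R S = IsQuasiOrder (Merged R S)

IsProperMerging : {m n : ℕ} → (Fin m → Fin n → Bool) → (Fin n → Fin m → Bool) → Set
IsProperMerging R S = IsMerging R S × (∀ i k → ¬ (R i k ≡ true × S k i ≡ true))

-- a_i R_π b_{n-j+1} iff π_{i,j} = 2 ; b_{n-j+1} S_π a_i iff π_{i,j} = 0.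
-- In 0-based indices, b_{n-j+1} for column j is  opposite j.  Since opposite is an
-- involution, b_k corresponds to column (opposite k).
Rπ : {m n : ℕ} → (Fin m → Fin n → ℕ) → Fin m → Fin n → Bool
Rπ π i k = π i (opposite k) ≡ᵇ 2

Sπ : {m n : ℕ} → (Fin m → Fin n → ℕ) → Fin n → Fin m → Bool
Sπ π k i = π i (opposite k) ≡ᵇ 0

-- Read an entry π i j of the plane partition as the relation between a_i and b_k, k = opposite j:
-- 2 means a_i ← b_k, 0 means b_k ← a_i, and 1 means the two are incomparable.
-- Monotonicity of π along rows and columns is exactly the closure of these relations under
-- composition with the two chains, i.e. transitivity of ←_{R,S}; properness excludes an entry
-- that is simultaneously 2 and 0, so every entry is recovered from the pair of bits.
module Submission where

open import Defs
open import Data.Nat using (ℕ; suc; _≤_; z≤n; s≤s; _≡ᵇ_; _∸_)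
open import Data.Nat.Properties using (∸-monoʳ-≤)
import Data.Nat.Properties as ℕ
open import Data.Fin using (Fin; opposite; toℕ) renaming (_≤_ to _≤F_)
open import Data.Fin.Properties using (opposite-prop; opposite-involutive; ≤-total)
import Data.Fin.Properties as Fin
open import Data.Bool using (Bool; true; false)
open import Data.Product using (_×_; Σ; _,_; proj₁; proj₂)
open import Data.Sum using (_⊎_; inj₁; inj₂; [_,_]′)
open import Data.Empty using (⊥-elim)
open import Function using (id; _∘_)
open import Relation.Binary.PropositionalEquality using (_≡_; refl; sym; subst)
open import Relation.Nullary using (¬_)

opposite-antitone : ∀ {n} {j j' : Fin n} → j ≤F j' → opposite j' ≤F opposite j
opposite-antitone {suc n} {j} {j'} j≤j' =
  subst (_≤ toℕ (opposite j)) (sym (opposite-prop j'))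
    (subst (suc n ∸ suc (toℕ j') ≤_) (sym (opposite-prop j))
      (∸-monoʳ-≤ (suc n) (s≤s j≤j')))

≡ᵇ2-upward : ∀ {x y} → x ≤ y → y ≤ 2 → (x ≡ᵇ 2) ≡ true → (y ≡ᵇ 2) ≡ true
≡ᵇ2-upward {2} (s≤s (s≤s z≤n)) (s≤s (s≤s z≤n)) _ = refl

≡ᵇ0-downward : ∀ {x y} → x ≤ y → (y ≡ᵇ 0) ≡ true → (x ≡ᵇ 0) ≡ true
≡ᵇ0-downward z≤n _ = refl

≡ᵇ2-below-≡ᵇ0-impossible : ∀ {x y} → x ≤ y → (x ≡ᵇ 2) ≡ true → ¬ (y ≡ᵇ 0) ≡ true
≡ᵇ2-below-≡ᵇ0-impossible {suc x} (s≤s _) _ ()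

≤2-determined-by-≡ᵇ2-≡ᵇ0 : ∀ {x y} → x ≤ 2 → y ≤ 2 →
  (x ≡ᵇ 2) ≡ (y ≡ᵇ 2) → (x ≡ᵇ 0) ≡ (y ≡ᵇ 0) → x ≡ y
≤2-determined-by-≡ᵇ2-≡ᵇ0 z≤n               z≤n               _  _  = refl
≤2-determined-by-≡ᵇ2-≡ᵇ0 z≤n               (s≤s z≤n)         _  ()
≤2-determined-by-≡ᵇ2-≡ᵇ0 z≤n               (s≤s (s≤s z≤n))   _  ()
≤2-determined-by-≡ᵇ2-≡ᵇ0 (s≤s z≤n)         z≤n               _  ()
≤2-determined-by-≡ᵇ2-≡ᵇ0 (s≤s z≤n)         (s≤s z≤n)         _  _  = refl
≤2-determined-by-≡ᵇ2-≡ᵇ0 (s≤s z≤n)         (s≤s (s≤s z≤n))   () _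
≤2-determined-by-≡ᵇ2-≡ᵇ0 (s≤s (s≤s z≤n))   z≤n               () _
≤2-determined-by-≡ᵇ2-≡ᵇ0 (s≤s (s≤s z≤n))   (s≤s z≤n)         () _
≤2-determined-by-≡ᵇ2-≡ᵇ0 (s≤s (s≤s z≤n))   (s≤s (s≤s z≤n))   _  _  = refl

-- The entry with R-bit r and S-bit s; the value for r = s = true is irrelevant.
level : Bool → Bool → ℕ
level true  _     = 2
level false true  = 0
level false false = 1

level-≤2 : ∀ r s → level r s ≤ 2
level-≤2 true  _     = ℕ.≤-refl
level-≤2 false true  = z≤n
level-≤2 false false = s≤s z≤n

level-≡ᵇ2 : ∀ r s → (level r s ≡ᵇ 2) ≡ r
level-≡ᵇ2 true  _     = refl
level-≡ᵇ2 false true  = refl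
level-≡ᵇ2 false false = refl

level-≡ᵇ0 : ∀ r s → ¬ (r ≡ true × s ≡ true) → (level r s ≡ᵇ 0) ≡ s
level-≡ᵇ0 true  true  r∧s = ⊥-elim (r∧s (refl , refl))
level-≡ᵇ0 true  false _   = refl
level-≡ᵇ0 false true  _   = refl
level-≡ᵇ0 false false _   = refl

level-mono : ∀ {r s r' s'} → (r ≡ true → r' ≡ true) → (s' ≡ true → s ≡ true) →
  level r s ≤ level r' s'
level-mono {true}  {_}     {true}  r⇒r' _ = ℕ.≤-refl
level-mono {true}  {_}     {false} r⇒r' _ with r⇒r' refl
... | ()
level-mono {false} {true}                    _ _     = z≤n
level-mono {false} {false} {true}            _ _     = s≤s z≤n
level-mono {false} {false} {false} {false}   _ _     = ℕ.≤-refl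
level-mono {false} {false} {false} {true}    _ s'⇒s with s'⇒s refl
... | ()

module _ {m n : ℕ} {π : Fin m → Fin n → ℕ} (pp : IsPP2 m n π) where
  open IsPP2 pp

  entry : Fin m → Fin n → ℕ
  entry i k = π i (opposite k)

  entry-antitoneₗ : ∀ {i i'} k → i ≤F i' → entry i' k ≤ entry i k
  entry-antitoneₗ k = colDec _ _ (opposite k)

  entry-monotoneᵣ : ∀ i {k k'} → k ≤F k' → entry i k ≤ entry i k'
  entry-monotoneᵣ i = rowDec i _ _ ∘ opposite-antitone

  private
    _←_ : Fin m ⊎ Fin n → Fin m ⊎ Fin n → Set
    _←_ = Merged (Rπ π) (Sπ π)

  Merged-refl : ∀ x → x ← x
  Merged-refl (inj₁ i) = Fin.≤-refl
  Merged-refl (inj₂ k) = Fin.≤-refl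

  Merged-trans : ∀ x y z → x ← y → y ← z → x ← z
  Merged-trans (inj₁ i) (inj₁ i') (inj₁ i'') = Fin.≤-trans
  Merged-trans (inj₁ i) (inj₁ i') (inj₂ k) i≤i' =
    ≡ᵇ2-upward (entry-antitoneₗ k i≤i') (bounded i (opposite k))
  Merged-trans (inj₁ i) (inj₂ k) (inj₁ i') iRk kSi' =
    [ id , (λ i'≤i → ⊥-elim (≡ᵇ2-below-≡ᵇ0-impossible (entry-antitoneₗ k i'≤i) iRk kSi')) ]′
      (≤-total i i')
  Merged-trans (inj₁ i) (inj₂ k) (inj₂ k') iRk k≤k' =
    ≡ᵇ2-upward (entry-monotoneᵣ i k≤k') (bounded i (opposite k')) iRk
  Merged-trans (inj₂ k) (inj₁ i) (inj₁ i') kSi i≤i' =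
    ≡ᵇ0-downward (entry-antitoneₗ k i≤i') kSi
  Merged-trans (inj₂ k) (inj₁ i) (inj₂ k') kSi iRk' =
    [ id , (λ k'≤k → ⊥-elim (≡ᵇ2-below-≡ᵇ0-impossible (entry-monotoneᵣ i k'≤k) iRk' kSi)) ]′
      (≤-total k k')
  Merged-trans (inj₂ k) (inj₂ k') (inj₁ i) k≤k' =
    ≡ᵇ0-downward (entry-monotoneᵣ i k≤k')
  Merged-trans (inj₂ k) (inj₂ k') (inj₂ k'') = Fin.≤-trans

  PP2⇒ProperMerging : IsProperMerging (Rπ π) (Sπ π)
  PP2⇒ProperMerging = (Merged-refl , Merged-trans) , λ i k (iRk , kSi) →
    ≡ᵇ2-below-≡ᵇ0-impossible (ℕ.≤-refl {entry i k}) iRk kSi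

PP2-injective : ∀ {m n} {π π' : Fin m → Fin n → ℕ} → IsPP2 m n π → IsPP2 m n π' →
  (∀ i k → Rπ π i k ≡ Rπ π' i k) → (∀ k i → Sπ π k i ≡ Sπ π' k i) →
  ∀ i j → π i j ≡ π' i j
PP2-injective {π = π} {π'} pp pp' R≡ S≡ i j =
  ≤2-determined-by-≡ᵇ2-≡ᵇ0 (IsPP2.bounded pp i j) (IsPP2.bounded pp' i j)
    (subst (λ j₀ → (π i j₀ ≡ᵇ 2) ≡ (π' i j₀ ≡ᵇ 2)) (opposite-involutive j) (R≡ i (opposite j)))
    (subst (λ j₀ → (π i j₀ ≡ᵇ 0) ≡ (π' i j₀ ≡ᵇ 0)) (opposite-involutive j) (S≡ (opposite j) i))

module _ {m n : ℕ} {R : Fin m → Fin n → Bool} {S : Fin n → Fin m → Bool}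
         (proper : IsProperMerging R S) where
  private
    trans← : ∀ x y z → Merged R S x y → Merged R S y z → Merged R S x z
    trans← = proj₂ (proj₁ proper)

  mergingPP : Fin m → Fin n → ℕ
  mergingPP i j = level (R i (opposite j)) (S (opposite j) i)

  mergingPP-isPP2 : IsPP2 m n mergingPP
  mergingPP-isPP2 = record
    { bounded = λ i j → level-≤2 _ _
    ; rowDec  = λ i j j' j≤j' → let oj'≤oj = opposite-antitone j≤j' in
        level-mono (λ iRoj' → trans← (inj₁ i) (inj₂ _) (inj₂ _) iRoj' oj'≤oj)
                   (λ ojSi → trans← (inj₂ _) (inj₂ _) (inj₁ i) oj'≤oj ojSi)
    ; colDec  = λ i i' j i≤i' →
        level-mono (λ i'Roj → trans← (inj₁ i) (inj₁ i') (inj₂ _) i≤i' i'Roj)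
                   (λ ojSi → trans← (inj₂ _) (inj₁ i) (inj₁ i') ojSi i≤i')
    }

  Rπ-mergingPP : ∀ i k → Rπ mergingPP i k ≡ R i k
  Rπ-mergingPP i k rewrite opposite-involutive k = level-≡ᵇ2 (R i k) (S k i)

  Sπ-mergingPP : ∀ k i → Sπ mergingPP k i ≡ S k i
  Sπ-mergingPP k i rewrite opposite-involutive k = level-≡ᵇ0 (R i k) (S k i) (proj₂ proper i k)

theorem3p4 : (m n : ℕ) →
    ((π : Fin m → Fin n → ℕ) → IsPP2 m n π → IsProperMerging (Rπ π) (Sπ π))
    × ((π π' : Fin m → Fin n → ℕ) → IsPP2 m n π → IsPP2 m n π' →
         (∀ i k → Rπ π i k ≡ Rπ π' i k) → (∀ k i → Sπ π k i ≡ Sπ π' k i) →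
         ∀ i j → π i j ≡ π' i j)
    × ((R : Fin m → Fin n → Bool) (S : Fin n → Fin m → Bool) → IsProperMerging R S →
         Σ (Fin m → Fin n → ℕ) λ π → IsPP2 m n π
           × (∀ i k → Rπ π i k ≡ R i k) × (∀ k i → Sπ π k i ≡ S k i))
theorem3p4 m n =
    (λ π → PP2⇒ProperMerging)
  , (λ π π' → PP2-injective)
  , (λ R S proper → mergingPP proper
                  , mergingPP-isPP2 proper , Rπ-mergingPP proper , Sπ-mergingPP proper)
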